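{- Let $(\Sigma_d,\Sigma_s,R_d,R_s)$ be a stream specification. Then it is productive for all ground terms of sort $s$ if and only if every ground term $t$ of sort $s$ admits a reduction $t\to^*_{R_s\cup R_d} u':t'$ for some terms $u',t'$.
   Context: Terms are many-sorted with two sorts, $s$ (streams) and $d$ (data). $\Sigma_d$ is a signature of symbols of type $d^n \to d$ ($n\ge 0$), and $R_d$ is a terminating orthogonal rewrite system over $\Sigma_d$; the set $D$ of data elements is the set of (unique) $R_d$-normal forms of ground terms over $\Sigma_d$. $\Sigma_s$ is a set of stream symbols, each of type $d^n\times s^m\to s$ ($n,m\ge 0$), and $:$ is a distinguished symbol not in $\Sigma_s$ of type $d\times s\to s$ (written infix). A stream specification $(\Sigma_d,\Sigma_s,R_d,R_s)$ consists of these data together with a set $R_s$ of rewrite rules over $\Sigma_d\cup\Sigma_s\cup\{:\}$, each of the form $f(u_1,\dots,u_n,t_1,\dots,t_m)\to t$, where: $f\in\Sigma_s$ has type $d^n\times s^m\to s$; each $t_i$ is either a variable of sort $s$ or of the form $x:\sigma$ with $x$ a variable of sort $d$ and $\sigma$ a variable of sort $s$; $t$ is any well-sorted term of sort $s$; $R_s\cup R_d$ is orthogonal; and every term $f(u_1,\dots,u_n,u_{n+1}:t_1,\dots,u_{n+m}:t_m)$ with $f\in\Sigma_s$ of type $d^n\times s^m\to s$ and $u_1,\dots,u_{n+m}\in D$ matches the left-hand side of some rule of $R_s$. The specification is productive for a ground term $t$ of sort $s$ if for every $n\in\mathbb{N}$ there is a reduction $t\to^*_{R_s\cup R_d} u_1:u_2:\cdots:u_n:t'$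 for some terms $u_1,\dots,u_n,t'$. -}

module Defs where

open import Data.Nat using (ℕ; zero; suc; _+_; _≤_)
open import Data.Fin using (Fin)
open import Data.Vec using (Vec; []; _∷_; lookup; _[_]≔_; zipWith; foldr)
open import Data.Vec.Relation.Unary.All using (All)
open import Data.Product using (Σ; ∃; ∃-syntax; _×_; _,_)
open import Data.Sum using (_⊎_)
open import Data.Empty using (⊥)
open import Relation.Nullary using (¬_)
open import Relation.Binary.PropositionalEquality using (_≡_)
open import Relation.Binary.Construct.Closure.ReflexiveTransitive using (Star)
open import Induction.WellFounded using (WellFounded)

data Sort : Set where
  d s : Sort

-- Σ_d : symbols of type dⁿ → d (dar = n)
-- Σ_s : symbols of type dⁿ × sᵐ → s (sdar = n, ssar = m)
record Signature : Set₁ where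
  field
    DSym : Set
    dar  : DSym → ℕ
    SSym : Set
    sdar : SSym → ℕ
    ssar : SSym → ℕ

module Spec (Sig : Signature) where
  open Signature Sig

  -- Well-sorted terms over Σ_d ∪ Σ_s ∪ {:}, with countably many
  -- variables (named by ℕ) of each sort.

  infixr 5 _∷ₛ_
  data Term : Sort → Set where
    var  : (σ : Sort) → ℕ → Term σ
    dapp : (f : DSym) → Vec (Term d) (dar f) → Term d
    sapp : (f : SSym) → Vec (Term d) (sdar f) → Vec (Term s) (ssar f) → Term s
    _∷ₛ_ : Term d → Term s → Term s

  IsVar : ∀ {σ} → Term σ → Set
  IsVar {σ} t = ∃[ x ] (t ≡ var σ x)

  mutual
    occ : Sort → ℕ → ∀ {σ} → Term σ → ℕ
    occ d x (var d y) with x Data.Nat.≟ y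
    ... | Relation.Nullary.yes _ = 1
    ... | Relation.Nullary.no _ = 0
    occ d x (var s y) = 0
    occ s x (var d y) = 0
    occ s x (var s y) with x Data.Nat.≟ y
    ... | Relation.Nullary.yes _ = 1
    ... | Relation.Nullary.no _ = 0
    occ τ x (dapp f ts) = occs τ x ts
    occ τ x (sapp f ts us) = occs τ x ts + occs τ x us
    occ τ x (u ∷ₛ t) = occ τ x u + occ τ x t

    occs : Sort → ℕ → ∀ {σ n} → Vec (Term σ) n → ℕ
    occs τ x [] = 0
    occs τ x (t ∷ ts) = occ τ x t + occs τ x ts

  Ground : ∀ {σ} → Term σ → Set
  Ground t = ∀ τ x → occ τ x t ≡ 0

  Subst : Set
  Subst = (σ : Sort) → ℕ → Term σ

  mutual
    _[_] : ∀ {σ} → Term σ → Subst → Term σ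
    var σ x [ θ ] = θ σ x
    dapp f ts [ θ ] = dapp f (ts [ θ ]*)
    sapp f ts us [ θ ] = sapp f (ts [ θ ]*) (us [ θ ]*)
    (u ∷ₛ t) [ θ ] = (u [ θ ]) ∷ₛ (t [ θ ])

    _[_]* : ∀ {σ n} → Vec (Term σ) n → Subst → Vec (Term σ) n
    [] [ θ ]* = []
    (t ∷ ts) [ θ ]* = (t [ θ ]) ∷ (ts [ θ ]*)

  -- subterm relation: u ⊑ t (u occurs in t), u ⊏ t (at a non-root position)
  mutual
    data _⊑_ {τ} (u : Term τ) : ∀ {σ} → Term σ → Set where
      here  : u ⊑ u
      below : ∀ {σ} {t : Term σ} → u ⊏ t → u ⊑ t

    data _⊏_ {τ} (u : Term τ) : ∀ {σ} → Term σ → Set where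
      dappArg  : ∀ {f ts} (i : Fin (dar f)) → u ⊑ lookup ts i → u ⊏ dapp f ts
      sappArgD : ∀ {f ts us} (i : Fin (sdar f)) → u ⊑ lookup ts i → u ⊏ sapp f ts us
      sappArgS : ∀ {f ts us} (i : Fin (ssar f)) → u ⊑ lookup us i → u ⊏ sapp f ts us
      consHd   : ∀ {h t} → u ⊑ h → u ⊏ (h ∷ₛ t)
      consTl   : ∀ {h t} → u ⊑ t → u ⊏ (h ∷ₛ t)

  record Rule (σ : Sort) : Set where
    constructor _⟶_
    field
      lhs rhs : Term σ
  open Rule public

  TRS : Set₁
  TRS = (σ : Sort) → Rule σ → Set

  WellFormedRule : ∀ {σ} → Rule σ → Set
  WellFormedRule ρ = ¬ IsVar (lhs ρ) × (∀ τ x → 1 ≤ occ τ x (rhs ρ) → 1 ≤ occ τ x (lhs ρ))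

  data Step (R : TRS) : ∀ {σ} → Term σ → Term σ → Set where
    root   : ∀ {σ} (ρ : Rule σ) → R σ ρ → (θ : Subst) → Step R (lhs ρ [ θ ]) (rhs ρ [ θ ])
    dappC  : ∀ {f ts t'} (i : Fin (dar f)) → Step R (lookup ts i) t' →
             Step R (dapp f ts) (dapp f (ts [ i ]≔ t'))
    sappCD : ∀ {f ts us t'} (i : Fin (sdar f)) → Step R (lookup ts i) t' →
             Step R (sapp f ts us) (sapp f (ts [ i ]≔ t') us)
    sappCS : ∀ {f ts us t'} (i : Fin (ssar f)) → Step R (lookup us i) t' →
             Step R (sapp f ts us) (sapp f ts (us [ i ]≔ t'))
    consCH : ∀ {h h' t} → Step R h h' → Step R (h ∷ₛ t) (h' ∷ₛ t)
    consCT : ∀ {h t t'} → Step R t t' → Step R (h ∷ₛ t) (h ∷ₛ t')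

  Steps : TRS → ∀ {σ} → Term σ → Term σ → Set
  Steps R = Star (Step R)

  NormalForm : TRS → ∀ {σ} → Term σ → Set
  NormalForm R t = ∀ t' → ¬ Step R t t'

  Terminating : TRS → Sort → Set
  Terminating R σ = WellFounded (λ (u t : Term σ) → Step R t u)

  LeftLinear : TRS → Set
  LeftLinear R = ∀ σ ρ → R σ ρ → ∀ τ x → occ τ x (lhs ρ) ≤ 1

  NonOverlapping : TRS → Set
  NonOverlapping R =
    (∀ σ τ (ρ₁ : Rule σ) (ρ₂ : Rule τ) → R σ ρ₁ → R τ ρ₂ →
       (u : Term τ) → ¬ IsVar u → u ⊏ lhs ρ₁ →
       (θ₁ θ₂ : Subst) → ¬ (u [ θ₁ ] ≡ lhs ρ₂ [ θ₂ ]))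
    ×
    (∀ σ (ρ₁ ρ₂ : Rule σ) → R σ ρ₁ → R σ ρ₂ →
       (θ₁ θ₂ : Subst) → lhs ρ₁ [ θ₁ ] ≡ lhs ρ₂ [ θ₂ ] → ρ₁ ≡ ρ₂)

  Orthogonal : TRS → Set
  Orthogonal R = LeftLinear R × NonOverlapping R

  onlyD : (Rule d → Set) → TRS
  onlyD Rd d = Rd
  onlyD Rd s = λ _ → ⊥

  _∪R_ : (Rule s → Set) → (Rule d → Set) → TRS
  (Rs ∪R Rd) d = Rd
  (Rs ∪R Rd) s = Rs

  IsData : (Rule d → Set) → Term d → Set
  IsData Rd u = Ground u × NormalForm (onlyD Rd) u

  StreamPat : Term s → Set
  StreamPat t = (∃[ y ] (t ≡ var s y)) ⊎ (∃[ x ] ∃[ y ] (t ≡ (var d x ∷ₛ var s y)))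

  StreamRuleShape : Rule s → Set
  StreamRuleShape ρ =
    Σ SSym λ f → Σ (Vec (Term d) (sdar f)) λ us → Σ (Vec (Term s) (ssar f)) λ ts →
      (lhs ρ ≡ sapp f us ts) × All StreamPat ts

  record IsStreamSpec (Rd : Rule d → Set) (Rs : Rule s → Set) : Set where
    field
      Rd-wf          : ∀ ρ → Rd ρ → WellFormedRule ρ
      Rs-wf          : ∀ ρ → Rs ρ → WellFormedRule ρ
      Rd-terminating : Terminating (onlyD Rd) d
      Rd-orthogonal  : Orthogonal (onlyD Rd)
      Rs-shape       : ∀ ρ → Rs ρ → StreamRuleShape ρ
      orthogonal     : Orthogonal (Rs ∪R Rd)
      exhaustive     : ∀ (f : SSym) (us : Vec (Term d) (sdar f))
                         (vs : Vec (Term d) (ssar f)) (ts : Vec (Term s) (ssar f)) →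
                         All (IsData Rd) us → All (IsData Rd) vs →
                         ∃[ ρ ] (Rs ρ × ∃[ θ ] (lhs ρ [ θ ] ≡ sapp f us (zipWith _∷ₛ_ vs ts)))

  prefix : ∀ {n} → Vec (Term d) n → Term s → Term s
  prefix us t = foldr _ _∷ₛ_ t us

  Productive : (Rule d → Set) → (Rule s → Set) → Term s → Set
  Productive Rd Rs t =
    ∀ n → ∃[ us ] ∃[ t' ] Steps (Rs ∪R Rd) t (prefix {n} us t')

  HeadNormalising : (Rule d → Set) → (Rule s → Set) → Term s → Set
  HeadNormalising Rd Rs t = ∃[ u' ] ∃[ t' ] Steps (Rs ∪R Rd) t (u' ∷ₛ t')

-- Reduction never creates variables, because every variable of a right-hand side
-- already occurs in its left-hand side; hence reducts of ground terms are ground.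
-- So if every ground stream term reduces to some u : t', then t' is again ground
-- and the head can be produced again, n times over.  The converse is the case n = 1.
module Submission where

open import Defs
open import Function.Bundles using (_⇔_; mk⇔)
open import Data.Nat using (ℕ; zero; suc; _+_; _≤_; z≤n; s≤s; _≟_)
open import Data.Nat.Properties using (m+n≡0⇒m≡0; m+n≡0⇒n≡0; m≤m+n; m≤n+m; ≤-trans)
open import Data.Fin using (zero; suc)
open import Data.Vec using (Vec; []; _∷_; lookup; _[_]≔_)
open import Data.Product using (∃-syntax; _×_; _,_; proj₂)
open import Data.Sum using (_⊎_; inj₁; inj₂)
open import Data.Empty using (⊥-elim)
open import Relation.Nullary using (yes; no)
open import Relation.Binary.PropositionalEquality using (_≡_; refl; cong₂; sym; subst)
open import Relation.Binary.Construct.Closure.ReflexiveTransitive using (ε; _◅_; _◅◅_; gmap)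

1≤m+n⇒1≤m⊎1≤n : ∀ m {n} → 1 ≤ m + n → 1 ≤ m ⊎ 1 ≤ n
1≤m+n⇒1≤m⊎1≤n zero    1≤n = inj₂ 1≤n
1≤m+n⇒1≤m⊎1≤n (suc m) _   = inj₁ (s≤s z≤n)

1≤m⇒1≤m+n : ∀ {m} n → 1 ≤ m → 1 ≤ m + n
1≤m⇒1≤m+n {m} n 1≤m = ≤-trans 1≤m (m≤m+n m n)

1≤n⇒1≤m+n : ∀ m {n} → 1 ≤ n → 1 ≤ m + n
1≤n⇒1≤m+n m {n} 1≤n = ≤-trans 1≤n (m≤n+m n m)

m≡0⇒n≡0⇒m+n≡0 : ∀ {m n} → m ≡ 0 → n ≡ 0 → m + n ≡ 0
m≡0⇒n≡0⇒m+n≡0 = cong₂ _+_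

module _ {Sig : Signature} where
  open Signature Sig
  open Spec Sig

  -- occ splits on the sort before the term, so these unfoldings need a case on τ.
  occ-dapp : ∀ τ x f (ts : Vec (Term d) (dar f)) → occ τ x (dapp f ts) ≡ occs τ x ts
  occ-dapp d x f ts = refl
  occ-dapp s x f ts = refl

  occ-sapp : ∀ τ x f (ts : Vec (Term d) (sdar f)) (us : Vec (Term s) (ssar f)) →
             occ τ x (sapp f ts us) ≡ occs τ x ts + occs τ x us
  occ-sapp d x f ts us = refl
  occ-sapp s x f ts us = refl

  occ-∷ₛ : ∀ τ x (u : Term d) (t : Term s) → occ τ x (u ∷ₛ t) ≡ occ τ x u + occ τ x t
  occ-∷ₛ d x u t = refl
  occ-∷ₛ s x u t = refl

  occ-var-self : ∀ σ y → 1 ≤ occ σ y (var σ y)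
  occ-var-self d y with y ≟ y
  ... | yes _ = s≤s z≤n
  ... | no y≢y = ⊥-elim (y≢y refl)
  occ-var-self s y with y ≟ y
  ... | yes _ = s≤s z≤n
  ... | no y≢y = ⊥-elim (y≢y refl)

  occ-var⇒≡ : ∀ σ y σ′ y′ → 1 ≤ occ σ y (var σ′ y′) → (σ ≡ σ′) × (y ≡ y′)
  occ-var⇒≡ d y d y′ h with y ≟ y′
  occ-var⇒≡ d y d y′ h  | yes y≡y′ = refl , y≡y′
  occ-var⇒≡ d y d y′ () | no _
  occ-var⇒≡ s y s y′ h with y ≟ y′
  occ-var⇒≡ s y s y′ h  | yes y≡y′ = refl , y≡y′
  occ-var⇒≡ s y s y′ () | no _
  occ-var⇒≡ d y s y′ ()
  occ-var⇒≡ s y d y′ ()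

  module _ (τ : Sort) (x : ℕ) where

    mutual
      fresh-[]⇒fresh-image : ∀ {ρ} (l : Term ρ) θ → occ τ x (l [ θ ]) ≡ 0 →
                             ∀ σ y → 1 ≤ occ σ y l → occ τ x (θ σ y) ≡ 0
      fresh-[]⇒fresh-image (var σ′ y′) θ fr σ y h with occ-var⇒≡ σ y σ′ y′ h
      ... | refl , refl = fr
      fresh-[]⇒fresh-image (dapp f ts) θ fr σ y h =
        fresh-[]*⇒fresh-image ts θ (subst (_≡ 0) (occ-dapp τ x f _) fr)
          σ y (subst (1 ≤_) (occ-dapp σ y f ts) h)
      fresh-[]⇒fresh-image (sapp f ts us) θ fr σ y h
        with subst (_≡ 0) (occ-sapp τ x f _ _) fr
           | 1≤m+n⇒1≤m⊎1≤n (occs σ y ts) (subst (1 ≤_) (occ-sapp σ y f ts us) h)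
      ... | fr′ | inj₁ h′ = fresh-[]*⇒fresh-image ts θ (m+n≡0⇒m≡0 _ fr′) σ y h′
      ... | fr′ | inj₂ h′ = fresh-[]*⇒fresh-image us θ (m+n≡0⇒n≡0 _ fr′) σ y h′
      fresh-[]⇒fresh-image (u ∷ₛ t) θ fr σ y h
        with subst (_≡ 0) (occ-∷ₛ τ x _ _) fr
           | 1≤m+n⇒1≤m⊎1≤n (occ σ y u) (subst (1 ≤_) (occ-∷ₛ σ y u t) h)
      ... | fr′ | inj₁ h′ = fresh-[]⇒fresh-image u θ (m+n≡0⇒m≡0 _ fr′) σ y h′
      ... | fr′ | inj₂ h′ = fresh-[]⇒fresh-image t θ (m+n≡0⇒n≡0 _ fr′) σ y h′

      fresh-[]*⇒fresh-image : ∀ {ρ n} (ls : Vec (Term ρ) n) θ → occs τ x (ls [ θ ]*) ≡ 0 →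
                              ∀ σ y → 1 ≤ occs σ y ls → occ τ x (θ σ y) ≡ 0
      fresh-[]*⇒fresh-image (l ∷ ls) θ fr σ y h with 1≤m+n⇒1≤m⊎1≤n (occ σ y l) h
      ... | inj₁ h′ = fresh-[]⇒fresh-image l θ (m+n≡0⇒m≡0 _ fr) σ y h′
      ... | inj₂ h′ = fresh-[]*⇒fresh-image ls θ (m+n≡0⇒n≡0 _ fr) σ y h′

    mutual
      fresh-image⇒fresh-[] : ∀ {ρ} (r : Term ρ) θ →
                             (∀ σ y → 1 ≤ occ σ y r → occ τ x (θ σ y) ≡ 0) →
                             occ τ x (r [ θ ]) ≡ 0
      fresh-image⇒fresh-[] (var σ y) θ fr = fr σ y (occ-var-self σ y)
      fresh-image⇒fresh-[] (dapp f ts) θ fr =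
        subst (_≡ 0) (sym (occ-dapp τ x f _))
          (fresh-image⇒fresh-[]* ts θ λ σ y h → fr σ y (subst (1 ≤_) (sym (occ-dapp σ y f ts)) h))
      fresh-image⇒fresh-[] (sapp f ts us) θ fr =
        subst (_≡ 0) (sym (occ-sapp τ x f _ _)) (m≡0⇒n≡0⇒m+n≡0
          (fresh-image⇒fresh-[]* ts θ λ σ y h →
            fr σ y (subst (1 ≤_) (sym (occ-sapp σ y f ts us)) (1≤m⇒1≤m+n _ h)))
          (fresh-image⇒fresh-[]* us θ λ σ y h →
            fr σ y (subst (1 ≤_) (sym (occ-sapp σ y f ts us)) (1≤n⇒1≤m+n (occs σ y ts) h))))
      fresh-image⇒fresh-[] (u ∷ₛ t) θ fr =
        subst (_≡ 0) (sym (occ-∷ₛ τ x _ _)) (m≡0⇒n≡0⇒m+n≡0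
          (fresh-image⇒fresh-[] u θ λ σ y h →
            fr σ y (subst (1 ≤_) (sym (occ-∷ₛ σ y u t)) (1≤m⇒1≤m+n _ h)))
          (fresh-image⇒fresh-[] t θ λ σ y h →
            fr σ y (subst (1 ≤_) (sym (occ-∷ₛ σ y u t)) (1≤n⇒1≤m+n (occ σ y u) h))))

      fresh-image⇒fresh-[]* : ∀ {ρ n} (rs : Vec (Term ρ) n) θ →
                              (∀ σ y → 1 ≤ occs σ y rs → occ τ x (θ σ y) ≡ 0) →
                              occs τ x (rs [ θ ]*) ≡ 0
      fresh-image⇒fresh-[]* []       θ fr = refl
      fresh-image⇒fresh-[]* (r ∷ rs) θ fr = m≡0⇒n≡0⇒m+n≡0
        (fresh-image⇒fresh-[] r θ λ σ y h → fr σ y (1≤m⇒1≤m+n _ h))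
        (fresh-image⇒fresh-[]* rs θ λ σ y h → fr σ y (1≤n⇒1≤m+n (occ σ y r) h))

    fresh-lookup : ∀ {ρ n} (ts : Vec (Term ρ) n) i → occs τ x ts ≡ 0 → occ τ x (lookup ts i) ≡ 0
    fresh-lookup (t ∷ ts) zero    fr = m+n≡0⇒m≡0 _ fr
    fresh-lookup (t ∷ ts) (suc i) fr = fresh-lookup ts i (m+n≡0⇒n≡0 (occ τ x t) fr)

    fresh-[]≔ : ∀ {ρ n} (ts : Vec (Term ρ) n) i t′ → occs τ x ts ≡ 0 → occ τ x t′ ≡ 0 →
                occs τ x (ts [ i ]≔ t′) ≡ 0
    fresh-[]≔ (t ∷ ts) zero    t′ fr fr′ = m≡0⇒n≡0⇒m+n≡0 fr′ (m+n≡0⇒n≡0 (occ τ x t) fr)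
    fresh-[]≔ (t ∷ ts) (suc i) t′ fr fr′ =
      m≡0⇒n≡0⇒m+n≡0 (m+n≡0⇒m≡0 _ fr) (fresh-[]≔ ts i t′ (m+n≡0⇒n≡0 (occ τ x t) fr) fr′)

  RhsVarsOccurInLhs : TRS → Set
  RhsVarsOccurInLhs R = ∀ σ ρ → R σ ρ → ∀ τ x → 1 ≤ occ τ x (rhs ρ) → 1 ≤ occ τ x (lhs ρ)

  module _ {R : TRS} (vars-ok : RhsVarsOccurInLhs R) where

    step-preserves-fresh : ∀ τ x {σ} {t t′ : Term σ} → Step R t t′ →
                           occ τ x t ≡ 0 → occ τ x t′ ≡ 0
    step-preserves-fresh τ x (root ρ r θ) fr =
      fresh-image⇒fresh-[] τ x (rhs ρ) θ λ σ y h →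
        fresh-[]⇒fresh-image τ x (lhs ρ) θ fr σ y (vars-ok _ ρ r σ y h)
    step-preserves-fresh τ x (dappC {f} {ts} i st) fr =
      let frs = subst (_≡ 0) (occ-dapp τ x f ts) fr in
      subst (_≡ 0) (sym (occ-dapp τ x f _))
        (fresh-[]≔ τ x ts i _ frs (step-preserves-fresh τ x st (fresh-lookup τ x ts i frs)))
    step-preserves-fresh τ x (sappCD {f} {ts} {us} i st) fr =
      let frs = subst (_≡ 0) (occ-sapp τ x f ts us) fr
          frts = m+n≡0⇒m≡0 _ frs in
      subst (_≡ 0) (sym (occ-sapp τ x f _ _)) (m≡0⇒n≡0⇒m+n≡0
        (fresh-[]≔ τ x ts i _ frts (step-preserves-fresh τ x st (fresh-lookup τ x ts i frts)))
        (m+n≡0⇒n≡0 _ frs))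
    step-preserves-fresh τ x (sappCS {f} {ts} {us} i st) fr =
      let frs = subst (_≡ 0) (occ-sapp τ x f ts us) fr
          frus = m+n≡0⇒n≡0 _ frs in
      subst (_≡ 0) (sym (occ-sapp τ x f _ _)) (m≡0⇒n≡0⇒m+n≡0
        (m+n≡0⇒m≡0 _ frs)
        (fresh-[]≔ τ x us i _ frus (step-preserves-fresh τ x st (fresh-lookup τ x us i frus))))
    step-preserves-fresh τ x (consCH {h} {_} {t} st) fr =
      let frs = subst (_≡ 0) (occ-∷ₛ τ x h t) fr in
      subst (_≡ 0) (sym (occ-∷ₛ τ x _ _)) (m≡0⇒n≡0⇒m+n≡0
        (step-preserves-fresh τ x st (m+n≡0⇒m≡0 _ frs)) (m+n≡0⇒n≡0 _ frs))
    step-preserves-fresh τ x (consCT {h} {t} st) fr =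
      let frs = subst (_≡ 0) (occ-∷ₛ τ x h t) fr in
      subst (_≡ 0) (sym (occ-∷ₛ τ x _ _)) (m≡0⇒n≡0⇒m+n≡0
        (m+n≡0⇒m≡0 _ frs) (step-preserves-fresh τ x st (m+n≡0⇒n≡0 _ frs)))

    steps-preserve-ground : ∀ {σ} {t t′ : Term σ} → Steps R t t′ → Ground t → Ground t′
    steps-preserve-ground ε          gr = gr
    steps-preserve-ground (st ◅ sts) gr =
      steps-preserve-ground sts λ τ x → step-preserves-fresh τ x st (gr τ x)

  ground-tail : ∀ {u : Term d} {t : Term s} → Ground (u ∷ₛ t) → Ground t
  ground-tail {u} {t} gr τ x = m+n≡0⇒n≡0 (occ τ x u) (subst (_≡ 0) (occ-∷ₛ τ x u t) (gr τ x))

  module _ {Rd : Rule d → Set} {Rs : Rule s → Set} where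

    streamSpec-rhsVarsOccurInLhs : IsStreamSpec Rd Rs → RhsVarsOccurInLhs (Rs ∪R Rd)
    streamSpec-rhsVarsOccurInLhs spec d ρ r = proj₂ (IsStreamSpec.Rd-wf spec ρ r)
    streamSpec-rhsVarsOccurInLhs spec s ρ r = proj₂ (IsStreamSpec.Rs-wf spec ρ r)

    headNormalising⇒prefixes : RhsVarsOccurInLhs (Rs ∪R Rd) →
      (∀ (t : Term s) → Ground t → HeadNormalising Rd Rs t) →
      ∀ n (t : Term s) → Ground t → ∃[ us ] ∃[ t′ ] Steps (Rs ∪R Rd) t (prefix {n} us t′)
    headNormalising⇒prefixes vars-ok hn zero    t gr = [] , t , ε
    headNormalising⇒prefixes vars-ok hn (suc n) t gr with hn t gr
    ... | u , t₁ , t→u∷t₁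
      with headNormalising⇒prefixes vars-ok hn n t₁
             (ground-tail (steps-preserve-ground vars-ok t→u∷t₁ gr))
    ... | us , t′ , t₁→us++t′ = u ∷ us , t′ , (t→u∷t₁ ◅◅ gmap _ consCT t₁→us++t′)

    productive⇒headNormalising : ∀ {t : Term s} → Productive Rd Rs t → HeadNormalising Rd Rs t
    productive⇒headNormalising prod with prod 1
    ... | u ∷ [] , t′ , t→u∷t′ = u , t′ , t→u∷t′

proposition2 : (Sig : Signature) → let open Spec Sig in
    (Rd : Rule d → Set) (Rs : Rule s → Set) → IsStreamSpec Rd Rs →
    ((∀ (t : Term s) → Ground t → Productive Rd Rs t)
    ⇔ (∀ (t : Term s) → Ground t → HeadNormalising Rd Rs t))
proposition2 Sig Rd Rs spec = mk⇔
  (λ prod t gr → productive⇒headNormalising (prod t gr))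
  (λ hn t gr n → headNormalising⇒prefixes (streamSpec-rhsVarsOccurInLhs spec) hn n t gr)
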